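{- Let $X$ be a multi-set and let $\tau$ be an integer. Suppose that for any $1 < d \le \tau$ the multi-set $X$ contains $d$ numbers not divisible by $d$, that is, $|\overline{X(d)}| \ge d$. Then for any $1 \le d \le \tau$ the set $\mathcal{S}(X)$ is $d$-complete, that is, $\mathcal{S}(X) \bmod d = \mathbb{Z}_d$.
   Context: $X$ is a finite non-empty multi-set of positive integers; $\mathcal{S}(X) := \{\Sigma(Y)\mid Y\subseteq X\}$ is the set of all subset sums, where $\Sigma(Y)$ is the sum of the elements of $Y$ (with multiplicity). For an integer $d$, $X(d) := X\cap d\mathbb{Z}$ and $\overline{X(d)} := X\setminus X(d)$; $|\cdot|$ counts with multiplicity. For a set $A$, $A\bmod d := \{a\bmod d\mid a\in A\}$. -}

module Defs where

open import Data.Nat using (ℕ; zero; suc; _+_; _<_; _≤_; NonZero)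
open import Data.Nat.Divisibility using (_∣_; _∣?_)
open import Data.Nat.DivMod using (_%_)
open import Data.Bool using (Bool; true; false)
open import Data.List using (List; []; _∷_; length; filter)
open import Relation.Nullary using (¬_)
open import Data.Product using (∃; _×_)
open import Relation.Binary.PropositionalEquality using (_≡_)
open import Relation.Nullary.Decidable using (¬?)

-- A finite multiset of naturals is represented as a list (order irrelevant,
-- multiplicities counted).

-- A sub-multiset Y ⊆ X is given by a choice of elements: a list of Booleans
-- (one per element of X) selecting which occurrences belong to Y.
-- Σ(Y) for the selection.
subsetSum : List ℕ → List Bool → ℕ
subsetSum []       _             = 0
subsetSum (x ∷ xs) []            = 0
subsetSum (x ∷ xs) (true  ∷ bs)  = x + subsetSum xs bs
subsetSum (x ∷ xs) (false ∷ bs)  = subsetSum xs bs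

_∈𝒮_ : ℕ → List ℕ → Set
s ∈𝒮 X = ∃ λ (bs : List Bool) → length bs ≡ length X × subsetSum X bs ≡ s

countNotDiv : ℕ → List ℕ → ℕ
countNotDiv d X = length (filter (λ x → ¬? (d ∣? x)) X)

dComplete : (d : ℕ) → .{{NonZero d}} → List ℕ → Set
dComplete d X = (r : ℕ) → r < d → ∃ λ s → s ∈𝒮 X × s % d ≡ r

-- Fix a modulus d and follow the set R of residues mod d of the subset sums while the
-- elements of X are added one at a time.  Adding a non-multiple x of d either enlarges R
-- or leaves R closed under +x, and closedness under +x survives all later additions.
-- Hence either |R| exceeds the number of non-multiples of d in X, which is ≥ d, so R is
-- everything; or R is closed under +x for some x ≢ 0 (mod d).  In the latter case R is
-- closed under adding any multiple of g = gcd(x, d) < d (Bézout), and by induction on d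
-- every residue mod g is hit, which lifts to every residue mod d.
module Submission where

open import Defs
open import Data.Nat using (ℕ; zero; suc; _+_; _*_; _<_; _≤_; z≤n; s≤s; NonZero; ≢-nonZero; >-nonZero⁻¹)
open import Data.Nat.Properties
open import Data.Nat.DivMod
open import Data.Nat.Divisibility using (_∣_; _∣?_; divides; ∣⇒≤; m%n≡0⇒n∣m)
open import Data.Nat.GCD using (gcd; gcd[m,n]∣m; gcd[m,n]∣n; gcd[m,n]≢0; gcd-GCD; module Bézout)
open import Data.Nat.Induction using (<-rec)
open import Data.Nat.Solver using (module +-*-Solver)
open import Data.List using (List; []; _∷_; length; filter; map; _++_; upTo)
open import Data.List.Properties using (length-filter; filter-accept; filter-reject; filter-notAll; filter-some; length-upTo)
open import Data.List.Membership.Propositional using (_∈_; lose; find)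
open import Data.List.Membership.Propositional.Properties
  using (∈-map⁺; ∈-map⁻; ∈-++⁺ˡ; ∈-++⁺ʳ; ∈-++⁻; ∈-upTo⁺; ∈-filter⁺)
open import Data.List.Relation.Unary.Any using (Any; here; any?)
open import Data.List.Relation.Unary.All using (All; all?; lookup; tabulate)
open import Data.List.Relation.Unary.All.Properties using (¬All⇒Any¬)
open import Data.Bool using (true; false)
open import Data.Product using (∃; _×_; _,_)
open import Data.Sum using (_⊎_; inj₁; inj₂)
open import Relation.Nullary using (¬_; Dec; yes; no; contradiction)
open import Relation.Nullary.Decidable using (¬?)
open import Relation.Unary using (Pred; Decidable; _⊆_)
open import Relation.Binary.PropositionalEquality
open import Function using (case_of_)

open import Algebra.Properties.CommutativeSemigroup +-commutativeSemigroup using (x∙yz≈y∙xz)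

open Bézout.Identity using (Identity; +-; -+)

subsetSums : List ℕ → List ℕ
subsetSums []       = 0 ∷ []
subsetSums (x ∷ xs) = map (x +_) (subsetSums xs) ++ subsetSums xs

0∈subsetSums : ∀ xs → 0 ∈ subsetSums xs
0∈subsetSums []       = here refl
0∈subsetSums (x ∷ xs) = ∈-++⁺ʳ _ (0∈subsetSums xs)

∈subsetSums-∷ : ∀ {s} x xs → s ∈ subsetSums xs → s ∈ subsetSums (x ∷ xs)
∈subsetSums-∷ x xs = ∈-++⁺ʳ (map (x +_) (subsetSums xs))

+∈subsetSums-∷ : ∀ {s} x xs → s ∈ subsetSums xs → x + s ∈ subsetSums (x ∷ xs)
+∈subsetSums-∷ x xs s∈ = ∈-++⁺ˡ (∈-map⁺ (x +_) s∈)

∈subsetSums-∷⁻ : ∀ {s} x xs → s ∈ subsetSums (x ∷ xs) →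
                 (∃ λ s′ → s′ ∈ subsetSums xs × s ≡ x + s′) ⊎ s ∈ subsetSums xs
∈subsetSums-∷⁻ x xs s∈ with ∈-++⁻ (map (x +_) (subsetSums xs)) s∈
... | inj₁ s∈map = inj₁ (∈-map⁻ (x +_) s∈map)
... | inj₂ s∈xs  = inj₂ s∈xs

∈subsetSums⇒∈𝒮 : ∀ {s} xs → s ∈ subsetSums xs → s ∈𝒮 xs
∈subsetSums⇒∈𝒮 []       (here refl) = [] , refl , refl
∈subsetSums⇒∈𝒮 (x ∷ xs) s∈ with ∈subsetSums-∷⁻ x xs s∈
... | inj₁ (s′ , s′∈ , refl) with bs , |bs| , Σbs ← ∈subsetSums⇒∈𝒮 xs s′∈ =
  true ∷ bs , cong suc |bs| , cong (x +_) Σbs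
... | inj₂ s∈xs with bs , |bs| , Σbs ← ∈subsetSums⇒∈𝒮 xs s∈xs =
  false ∷ bs , cong suc |bs| , Σbs

module _ {a p q} {A : Set a} {P : Pred A p} {Q : Pred A q} (P? : Decidable P) (Q? : Decidable Q) (P⊆Q : P ⊆ Q) where

  filter-absorbs : ∀ xs → filter P? (filter Q? xs) ≡ filter P? xs
  filter-absorbs []       = refl
  filter-absorbs (x ∷ xs) with Q? x
  ... | no ¬qx = trans (filter-absorbs xs) (sym (filter-reject P? (λ px → ¬qx (P⊆Q px))))
  ... | yes _ with P? x
  ...   | yes _ = cong (x ∷_) (filter-absorbs xs)
  ...   | no  _ = filter-absorbs xs

  length-filter-mono : ∀ xs → length (filter P? xs) ≤ length (filter Q? xs)
  length-filter-mono xs = subst (_≤ _) (cong length (filter-absorbs xs)) (length-filter P? (filter Q? xs))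

  length-filter-mono-< : ∀ {t} xs → t ∈ xs → Q t → ¬ P t →
                         length (filter P? xs) < length (filter Q? xs)
  length-filter-mono-< xs t∈ qt ¬pt =
    subst (_< _) (cong length (filter-absorbs xs)) (filter-notAll P? (filter Q? xs) (lose (∈-filter⁺ Q? t∈ qt) ¬pt))

[m+n]%d≡[m+o]%d : ∀ m {n o d} .{{_ : NonZero d}} → n % d ≡ o % d → (m + n) % d ≡ (m + o) % d
[m+n]%d≡[m+o]%d m {n} {o} {d} n≡o = begin
  (m + n) % d          ≡⟨ %-distribˡ-+ m n d ⟩
  (m % d + n % d) % d  ≡⟨ cong (λ t → (m % d + t) % d) n≡o ⟩
  (m % d + o % d) % d  ≡⟨ %-distribˡ-+ m o d ⟨
  (m + o) % d          ∎
  where open ≡-Reasoning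

[m+n]%d≡n%d⇒d∣m : ∀ m n d .{{_ : NonZero d}} → (m + n) % d ≡ n % d → d ∣ m
[m+n]%d≡n%d⇒d∣m m n d@(suc k) m+n≡n = m%n≡0⇒n∣m m d (begin
  m % d                  ≡⟨ [m+kn]%n≡m%n m n d ⟨
  (m + n * d) % d        ≡⟨ cong (_% d) (solve 3 (λ m n k → m :+ n :* (con 1 :+ k) := n :* k :+ (m :+ n)) refl m n k) ⟩
  (n * k + (m + n)) % d  ≡⟨ [m+n]%d≡[m+o]%d (n * k) m+n≡n ⟩
  (n * k + n) % d        ≡⟨ cong (_% d) (solve 2 (λ n k → n :* k :+ n := n :* (con 1 :+ k)) refl n k) ⟩
  (n * d) % d            ≡⟨ m*n%n≡0 n d ⟩
  0                      ∎)
  where open ≡-Reasoning; open +-*-Solver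

-- The witness m + (d − 1) n is m − n modulo d, without truncated subtraction.
residue-difference : ∀ m n d .{{_ : NonZero d}} → ∃ λ c → (c + n) % d ≡ m % d
residue-difference m n d@(suc k) = m + k * n , (begin
  (m + k * n + n) % d  ≡⟨ cong (_% d) (solve 3 (λ m n k → m :+ k :* n :+ n := m :+ n :* (con 1 :+ k)) refl m n k) ⟩
  (m + n * d) % d      ≡⟨ [m+kn]%n≡m%n m n d ⟩
  m % d                ∎)
  where open ≡-Reasoning; open +-*-Solver

bézout-mod : ∀ {g x d c} .{{_ : NonZero d}} → Identity g x d → g ∣ c → ∃ λ m → (m * x) % d ≡ c % d
bézout-mod {g} {x} {d} (+- a b g+bd≡ax) (divides k refl) = k * a , (begin
  (k * a * x) % d            ≡⟨ cong (_% d) (*-assoc k a x) ⟩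
  (k * (a * x)) % d          ≡⟨ cong (λ t → (k * t) % d) g+bd≡ax ⟨
  (k * (g + b * d)) % d      ≡⟨ cong (_% d) (solve 4 (λ k g b d → k :* (g :+ b :* d) := k :* g :+ k :* b :* d) refl k g b d) ⟩
  (k * g + k * b * d) % d    ≡⟨ [m+kn]%n≡m%n (k * g) (k * b) d ⟩
  (k * g) % d                ∎)
  where open ≡-Reasoning; open +-*-Solver
-- Here k g ≡ −k a x, so the multiplier is −k a ≡ k a (d − 1).
bézout-mod {g} {x} {d@(suc n)} (-+ a b g+ax≡bd) (divides k refl) = k * a * n , (begin
  (k * a * n * x) % d                    ≡⟨ [m+kn]%n≡m%n (k * a * n * x) (k * b) d ⟨
  (k * a * n * x + k * b * d) % d        ≡⟨ cong (λ t → (k * a * n * x + t) % d) (*-assoc k b d) ⟩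
  (k * a * n * x + k * (b * d)) % d      ≡⟨ cong (λ t → (k * a * n * x + k * t) % d) g+ax≡bd ⟨
  (k * a * n * x + k * (g + a * x)) % d  ≡⟨ cong (_% d) (solve 5 (λ k a n x g → k :* a :* n :* x :+ k :* (g :+ a :* x) := k :* g :+ k :* a :* x :* (con 1 :+ n)) refl k a n x g) ⟩
  (k * g + k * a * x * d) % d            ≡⟨ [m+kn]%n≡m%n (k * g) (k * a * x) d ⟩
  (k * g) % d                            ∎)
  where open ≡-Reasoning; open +-*-Solver

countNotDiv-∷-∣ : ∀ {d x} xs → d ∣ x → countNotDiv d (x ∷ xs) ≡ countNotDiv d xs
countNotDiv-∷-∣ {d} xs d∣x = cong length (filter-reject (λ y → ¬? (d ∣? y)) (λ ¬d∣x → ¬d∣x d∣x))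

countNotDiv-∷-∤ : ∀ {d x} xs → ¬ d ∣ x → countNotDiv d (x ∷ xs) ≡ suc (countNotDiv d xs)
countNotDiv-∷-∤ {d} xs ¬d∣x = cong length (filter-accept (λ y → ¬? (d ∣? y)) ¬d∣x)

module Residues (d : ℕ) .{{_ : NonZero d}} where

  Reachable : List ℕ → ℕ → Set
  Reachable xs r = Any (λ s → s % d ≡ r) (subsetSums xs)

  reachable? : ∀ xs → Decidable (Reachable xs)
  reachable? xs r = any? (λ s → s % d ≟ r) (subsetSums xs)

  Complete : List ℕ → Set
  Complete xs = ∀ r → r < d → Reachable xs r

  ClosedUnder : List ℕ → ℕ → Set
  ClosedUnder xs x = All (λ s → Reachable xs ((x + s) % d)) (subsetSums xs)

  closedUnder? : ∀ xs x → Dec (ClosedUnder xs x)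
  closedUnder? xs x = all? (λ s → reachable? xs ((x + s) % d)) (subsetSums xs)

  count : List ℕ → ℕ
  count xs = length (filter (reachable? xs) (upTo d))

  Reachable-∷ : ∀ {r} y xs → Reachable xs r → Reachable (y ∷ xs) r
  Reachable-∷ y xs reach with s , s∈ , s≡r ← find reach = lose (∈subsetSums-∷ y xs s∈) s≡r

  Reachable-+-∷ : ∀ {t} y xs → Reachable xs (t % d) → Reachable (y ∷ xs) ((y + t) % d)
  Reachable-+-∷ y xs reach with s , s∈ , s≡t ← find reach =
    lose (+∈subsetSums-∷ y xs s∈) ([m+n]%d≡[m+o]%d y s≡t)

  ClosedUnder-∷ : ∀ {x} y xs → ClosedUnder xs x → ClosedUnder (y ∷ xs) x
  ClosedUnder-∷ {x} y xs closed = tabulate closed′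
    where
    closed′ : ∀ {s} → s ∈ subsetSums (y ∷ xs) → Reachable (y ∷ xs) ((x + s) % d)
    closed′ s∈ with ∈subsetSums-∷⁻ y xs s∈
    ... | inj₂ s∈xs = Reachable-∷ y xs (lookup closed s∈xs)
    ... | inj₁ (s′ , s′∈ , refl) =
      subst (Reachable (y ∷ xs)) (cong (_% d) (x∙yz≈y∙xz y x s′)) (Reachable-+-∷ y xs (lookup closed s′∈))

  ClosedUnder-* : ∀ {x xs} → ClosedUnder xs x → ∀ m {s} → s ∈ subsetSums xs → Reachable xs ((m * x + s) % d)
  ClosedUnder-* closed zero    s∈ = lose s∈ refl
  ClosedUnder-* {x} {xs} closed (suc m) {s} s∈
    with t , t∈ , t≡mx+s ← find (ClosedUnder-* {x} {xs} closed m s∈) =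
    subst (Reachable xs) x+t≡[1+m]x+s (lookup closed t∈)
    where
    x+t≡[1+m]x+s : (x + t) % d ≡ (suc m * x + s) % d
    x+t≡[1+m]x+s = trans ([m+n]%d≡[m+o]%d x t≡mx+s) (cong (_% d) (sym (+-assoc x (m * x) s)))

  0<count : ∀ xs → 0 < count xs
  0<count xs = filter-some (reachable? xs) (lose (∈-upTo⁺ (>-nonZero⁻¹ d)) reachable-0)
    where
    reachable-0 : Reachable xs 0
    reachable-0 = lose (0∈subsetSums xs) (m<n⇒m%n≡m (>-nonZero⁻¹ d))

  count-mono-∷ : ∀ y xs → count xs ≤ count (y ∷ xs)
  count-mono-∷ y xs = length-filter-mono (reachable? xs) (reachable? (y ∷ xs)) (Reachable-∷ y xs) (upTo d)

  count-<-∷ : ∀ x xs → ¬ ClosedUnder xs x → count xs < count (x ∷ xs)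
  count-<-∷ x xs ¬closed
    with s , s∈ , unreachable ← find (¬All⇒Any¬ (λ s → reachable? xs ((x + s) % d)) (subsetSums xs) ¬closed) =
    length-filter-mono-< (reachable? xs) (reachable? (x ∷ xs)) (Reachable-∷ x xs) (upTo d)
      (∈-upTo⁺ (m%n<n (x + s) d)) (lose (+∈subsetSums-∷ x xs s∈) refl) unreachable

  d≤count⇒complete : ∀ xs → d ≤ count xs → Complete xs
  d≤count⇒complete xs d≤count r r<d with reachable? xs r
  ... | yes reach = reach
  ... | no ¬reach = contradiction d≤count (<⇒≱ (subst (count xs <_) (length-upTo d)
                      (filter-notAll (reachable? xs) (upTo d) (lose (∈-upTo⁺ r<d) ¬reach))))

  notDiv<count⊎closed : ∀ xs → countNotDiv d xs < count xs ⊎ ∃ λ x → ¬ d ∣ x × ClosedUnder xs x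
  notDiv<count⊎closed []       = inj₁ (0<count [])
  notDiv<count⊎closed (y ∷ xs) with notDiv<count⊎closed xs
  ... | inj₂ (x , ¬d∣x , closed) = inj₂ (x , ¬d∣x , ClosedUnder-∷ y xs closed)
  ... | inj₁ notDiv<count = case d ∣? y of λ where
    (yes d∣y) → inj₁ (subst (_< count (y ∷ xs)) (sym (countNotDiv-∷-∣ xs d∣y))
                       (≤-trans notDiv<count (count-mono-∷ y xs)))
    (no ¬d∣y) → case closedUnder? xs y of λ where
      (yes closed) → inj₂ (y , ¬d∣y , ClosedUnder-∷ y xs closed)
      (no ¬closed) → inj₁ (subst (_< count (y ∷ xs)) (sym (countNotDiv-∷-∤ xs ¬d∣y))
                             (≤-trans (s≤s notDiv<count) (count-<-∷ y xs ¬closed)))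

closed⇒complete : ∀ {g d x xs} .{{_ : NonZero g}} .{{_ : NonZero d}} → g ∣ d → Identity g x d →
                  Residues.ClosedUnder d xs x → Residues.Complete g xs → Residues.Complete d xs
closed⇒complete {g} {d} {x} {xs} g∣d bézout closed complete-g r r<d =
  let s , s∈ , s≡r[g] = find (complete-g (r % g) (m%n<n r g))
      c , c+s≡r[d]    = residue-difference r s d
      c+s≡s[g] : (c + s) % g ≡ s % g
      c+s≡s[g] = begin
        (c + s) % g      ≡⟨ m∣n⇒o%n%m≡o%m g d (c + s) g∣d ⟨
        (c + s) % d % g  ≡⟨ cong (_% g) c+s≡r[d] ⟩
        r % d % g        ≡⟨ m∣n⇒o%n%m≡o%m g d r g∣d ⟩
        r % g            ≡⟨ s≡r[g] ⟨
        s % g            ∎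
      m , mx≡c[d]     = bézout-mod bézout ([m+n]%d≡n%d⇒d∣m c s g c+s≡s[g])
      mx+s≡r : (m * x + s) % d ≡ r
      mx+s≡r = begin
        (m * x + s) % d  ≡⟨ cong (_% d) (+-comm (m * x) s) ⟩
        (s + m * x) % d  ≡⟨ [m+n]%d≡[m+o]%d s mx≡c[d] ⟩
        (s + c) % d      ≡⟨ cong (_% d) (+-comm s c) ⟩
        (c + s) % d      ≡⟨ c+s≡r[d] ⟩
        r % d            ≡⟨ m<n⇒m%n≡m r<d ⟩
        r                ∎
  in subst (Residues.Reachable d xs) mx+s≡r (Residues.ClosedUnder-* d {xs = xs} closed m s∈)
  where open ≡-Reasoning

complete-upTo : ∀ xs τ → (∀ d → 1 < d → d ≤ τ → d ≤ countNotDiv d xs) →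
                ∀ d .{{_ : NonZero d}} → d ≤ τ → Residues.Complete d xs
complete-upTo xs τ many-notDiv = <-rec P complete-below
  where
  P : ℕ → Set
  P d = .{{_ : NonZero d}} → d ≤ τ → Residues.Complete d xs

  complete-below : ∀ d → (∀ {g} → g < d → P g) → P d
  complete-below 1 _ _ zero    _          = lose (0∈subsetSums xs) refl
  complete-below 1 _ _ (suc r) (s≤s ())
  complete-below d@(suc (suc _)) ih d≤τ with Residues.notDiv<count⊎closed d xs
  ... | inj₁ notDiv<count =
    Residues.d≤count⇒complete d xs (≤-trans (many-notDiv d (s≤s (s≤s z≤n)) d≤τ) (<⇒≤ notDiv<count))
  ... | inj₂ (x , ¬d∣x , closed) =
    closed⇒complete {xs = xs} {{g≢0}} (gcd[m,n]∣n x d) (Bézout.identity (gcd-GCD x d)) closed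
      (ih g<d {{g≢0}} (≤-trans (<⇒≤ g<d) d≤τ))
    where
    g≢0 : NonZero (gcd x d)
    g≢0 = ≢-nonZero (gcd[m,n]≢0 x d (inj₂ λ ()))
    g<d : gcd x d < d
    g<d = ≤∧≢⇒< (∣⇒≤ (gcd[m,n]∣n x d)) (λ g≡d → ¬d∣x (subst (_∣ x) g≡d (gcd[m,n]∣m x d)))

theorem4p13 : (X : List ℕ) → X ≢ [] → All (λ x → 0 < x) X → (τ : ℕ)
    → (∀ d → 1 < d → d ≤ τ → d ≤ countNotDiv d X)
    → ∀ k → suc k ≤ τ → dComplete (suc k) X
theorem4p13 X _ _ τ many-notDiv k 1+k≤τ r r<1+k
  with s , s∈ , s≡r ← find (complete-upTo X τ many-notDiv (suc k) 1+k≤τ r r<1+k) =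
  s , ∈subsetSums⇒∈𝒮 X s∈ , s≡r
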